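{- Every graph in $\varepsilon_2$ has at least one vertex of degree $2$.
   Context: All graphs are finite, simple, undirected and connected. An Euler graph is a connected graph in which every vertex has even degree. $\varepsilon_2$ denotes the class of Euler graphs $G$ such that every cycle of $G$ has length $n\equiv 2 \pmod 4$. -}

module Defs where

open import Data.Nat using (ℕ; zero; suc; _+_; _∸_; _≤_; _%_)
open import Data.Nat.Divisibility using (_∣_)
open import Data.Fin using (Fin; toℕ)
open import Data.Bool using (Bool; true; false; if_then_else_)
open import Data.List using (List; map; allFin)
open import Data.Nat.ListAction using (sum)
open import Data.Product using (Σ; _×_)
open import Relation.Binary.PropositionalEquality using (_≡_)
open import Function.Definitions using (Injective)

record Graph (n : ℕ) : Set where
  field
    Adj     : Fin n → Fin n → Bool
    sym     : ∀ i j → Adj i j ≡ Adj j i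
    irrefl  : ∀ i → Adj i i ≡ false
open Graph public

degree : ∀ {n} → Graph n → Fin n → ℕ
degree {n} G v = sum (map (λ j → if Adj G v j then 1 else 0) (allFin n))

data Walk {n} (G : Graph n) : Fin n → Fin n → Set where
  here : ∀ {u} → Walk G u u
  step : ∀ {u w v} → Adj G u w ≡ true → Walk G w v → Walk G u v

Connected : ∀ {n} → Graph n → Set
Connected G = ∀ u v → Walk G u v

EulerGraph : ∀ {n} → Graph n → Set
EulerGraph G = Connected G × (∀ v → 2 ∣ degree G v)

record Cycle {n} (G : Graph n) (k : ℕ) : Set where
  field
    len≥3   : 3 ≤ k
    vert    : Fin k → Fin n
    distinct : Injective _≡_ _≡_ vert
    consec  : ∀ i j → suc (toℕ i) ≡ toℕ j → Adj G (vert i) (vert j) ≡ true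
    closing : ∀ i j → toℕ i ≡ k ∸ 1 → toℕ j ≡ 0 → Adj G (vert i) (vert j) ≡ true

InEps2 : ∀ {n} → Graph n → Set
InEps2 G = EulerGraph G × (∀ k → Cycle G k → k % 4 ≡ 2)

-- Suppose no vertex has degree 2. Evenness and connectivity then force minimum degree 4,
-- while every cycle has length ≡ 2 (mod 4). All neighbours of the start v₀ of a longest
-- path v₀ … v_L lie on it, so there is a chord v₀ v_a with a ≥ 2; we descend on a.
-- Rotating at the chord gives a longest path starting at v_{a-1}, and a neighbour of
-- v_{a-1} other than v_{a-2}, v_a is either an earlier vertex, giving a shorter chord of
-- the rotated path, or some v_j with j > a. In the latter case pick a neighbour v_x of v₀
-- other than v₁, v_a, v_j. If x < a the chord v₀ v_x is shorter; otherwise the cycles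
-- v₀ … v_x, v_{a-1} … v₀ v_a … v_j and the detour v₀ v_a v_{a-1} v_j … v_x (or its mirror
-- when x < j) have lengths x + 1, j + 1 and 4 + |x − j|, which cannot all be ≡ 2 (mod 4).
module Submission where

open import Defs hiding (sym)
open import Data.Nat using (ℕ; zero; suc; _+_; _∸_; _≤_; _<_; _%_; z≤n; s≤s; _≤?_; _<?_)
open import Data.Nat.Properties
open import Data.Nat.Divisibility using (_∣_; divides)
open import Data.Nat.DivMod using (%-distribˡ-+; [m+n]%n≡m%n)
open import Data.Nat.Induction using (<-rec)
open import Data.Nat.ListAction using (sum)
open import Data.Fin using (Fin; toℕ) renaming (zero to fzero; suc to fsuc)
open import Data.Fin.Properties
  using (any?; pigeonhole; toℕ-injective; toℕ≤pred[n]; punchInᵢ≢i) renaming (_≟_ to _≟ᶠ_)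
open import Data.Fin.Subset using (Subset; inside; outside; _∈_; _∉_; _⊆_; _∪_; ⁅_⁆; ∣_∣)
open import Data.Fin.Subset.Properties
  using (_∈?_; p⊆q⇒∣p∣≤∣q∣; ∣p∣≤∣x∷p∣; ∣⁅x⁆∣≡1; x∈⁅x⁆; x∈⁅y⁆⇒x≡y; x∈p∪q⁺)
open import Data.Bool using (Bool; true; false; if_then_else_)
import Data.List as List
open import Data.List.Properties using (map-tabulate)
open import Data.Vec using (_∷_; [])
import Data.Vec as Vec
open import Data.Vec.Properties using ([]=⇒lookup; lookup⇒[]=; lookup∘tabulate)
open import Data.Product using (Σ; ∃; _×_; _,_)
open import Data.Sum using (inj₁; inj₂)
open import Data.Empty using (⊥; ⊥-elim)
open import Function using (id; _∘_)
open import Relation.Nullary using (¬_; Dec; yes; no)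
open import Relation.Nullary.Decidable using (_×-dec_; ¬?; decidable-stable; map′)
open import Relation.Binary.PropositionalEquality
open import Relation.Binary.Definitions using (Tri; tri<; tri≈; tri>)

∣p∪q∣≤∣p∣+∣q∣ : ∀ {n} (p q : Subset n) → ∣ p ∪ q ∣ ≤ ∣ p ∣ + ∣ q ∣
∣p∪q∣≤∣p∣+∣q∣ []            []            = z≤n
∣p∪q∣≤∣p∣+∣q∣ (outside ∷ p) (outside ∷ q) = ∣p∪q∣≤∣p∣+∣q∣ p q
∣p∪q∣≤∣p∣+∣q∣ (outside ∷ p) (inside  ∷ q) =
  ≤-trans (s≤s (∣p∪q∣≤∣p∣+∣q∣ p q)) (≤-reflexive (sym (+-suc ∣ p ∣ ∣ q ∣)))
∣p∪q∣≤∣p∣+∣q∣ (inside  ∷ p) (t       ∷ q) =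
  s≤s (≤-trans (∣p∪q∣≤∣p∣+∣q∣ p q) (+-monoʳ-≤ ∣ p ∣ (∣p∣≤∣x∷p∣ t q)))

∣⁅x⁆∪⁅y⁆∪⁅z⁆∣≤3 : ∀ {n} (x y z : Fin n) → ∣ ⁅ x ⁆ ∪ ⁅ y ⁆ ∪ ⁅ z ⁆ ∣ ≤ 3
∣⁅x⁆∪⁅y⁆∪⁅z⁆∣≤3 x y z = begin
  ∣ ⁅ x ⁆ ∪ ⁅ y ⁆ ∪ ⁅ z ⁆ ∣            ≤⟨ ∣p∪q∣≤∣p∣+∣q∣ ⁅ x ⁆ _ ⟩
  ∣ ⁅ x ⁆ ∣ + ∣ ⁅ y ⁆ ∪ ⁅ z ⁆ ∣        ≤⟨ +-monoʳ-≤ ∣ ⁅ x ⁆ ∣ (∣p∪q∣≤∣p∣+∣q∣ ⁅ y ⁆ ⁅ z ⁆) ⟩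
  ∣ ⁅ x ⁆ ∣ + (∣ ⁅ y ⁆ ∣ + ∣ ⁅ z ⁆ ∣)
    ≡⟨ cong₂ _+_ (∣⁅x⁆∣≡1 x) (cong₂ _+_ (∣⁅x⁆∣≡1 y) (∣⁅x⁆∣≡1 z)) ⟩
  3                                   ∎
  where open ≤-Reasoning

sum-indicator≡∣tabulate∣ : ∀ {n} (b : Fin n → Bool) →
  sum (List.tabulate (λ j → if b j then 1 else 0)) ≡ ∣ Vec.tabulate b ∣
sum-indicator≡∣tabulate∣ {zero}  b = refl
sum-indicator≡∣tabulate∣ {suc n} b with b fzero
... | true  = cong suc (sum-indicator≡∣tabulate∣ (b ∘ fsuc))
... | false = sum-indicator≡∣tabulate∣ (b ∘ fsuc)

even∧positive∧≢2⇒≥4 : ∀ {d} → 2 ∣ d → 1 ≤ d → d ≢ 2 → 4 ≤ d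
even∧positive∧≢2⇒≥4 (divides 0 refl) () _
even∧positive∧≢2⇒≥4 (divides 1 refl) _ d≢2 = ⊥-elim (d≢2 refl)
even∧positive∧≢2⇒≥4 (divides (suc (suc q)) refl) _ _ = s≤s (s≤s (s≤s (s≤s z≤n)))

≡2[mod4]⇒detour≢2[mod4] : ∀ {lo hi} → lo ≤ hi → suc lo % 4 ≡ 2 → suc hi % 4 ≡ 2 →
  (4 + (hi ∸ lo)) % 4 ≢ 2
≡2[mod4]⇒detour≢2[mod4] {lo} {hi} lo≤hi lo≡2 hi≡2 detour≡2 =
  0≢1+n (trans (sym hi≡0) hi≡2)
  where
  d = hi ∸ lo
  d≡2 : d % 4 ≡ 2
  d≡2 = trans (sym (trans (cong (_% 4) (+-comm 4 d)) ([m+n]%n≡m%n d 4))) detour≡2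
  hi≡0 : suc hi % 4 ≡ 0
  hi≡0 = begin
    suc hi % 4                 ≡⟨ cong (λ h → suc h % 4) (sym (m+[n∸m]≡n lo≤hi)) ⟩
    (suc lo + d) % 4           ≡⟨ %-distribˡ-+ (suc lo) d 4 ⟩
    (suc lo % 4 + d % 4) % 4   ≡⟨ cong₂ (λ x y → (x + y) % 4) lo≡2 d≡2 ⟩
    0                          ∎
    where open ≡-Reasoning

rotation : ℕ → ℕ → ℕ
rotation a i with i ≤? a
... | yes _ = a ∸ i
... | no  _ = i

rotation-≤ : ∀ {a i} → i ≤ a → rotation a i ≡ a ∸ i
rotation-≤ {a} {i} i≤a with i ≤? a
... | yes _   = refl
... | no  i≰a = ⊥-elim (i≰a i≤a)

rotation-> : ∀ {a i} → a < i → rotation a i ≡ i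
rotation-> {a} {i} a<i with i ≤? a
... | yes i≤a = ⊥-elim (<⇒≱ a<i i≤a)
... | no  _   = refl

module _ {n} (G : Graph n) where

  infix 4 _~_
  _~_ : Fin n → Fin n → Set
  u ~ v = Adj G u v ≡ true

  ~-sym : ∀ {u v} → u ~ v → v ~ u
  ~-sym {u} {v} = trans (Graph.sym G v u)

  ~-irrefl : ∀ {u} → ¬ u ~ u
  ~-irrefl {u} u~u with () ← trans (sym u~u) (irrefl G u)

  neighbourhood : Fin n → Subset n
  neighbourhood v = Vec.tabulate (Adj G v)

  ∈-neighbourhood⁺ : ∀ {v w} → v ~ w → w ∈ neighbourhood v
  ∈-neighbourhood⁺ {v} {w} v~w = lookup⇒[]= w _ (trans (lookup∘tabulate (Adj G v) w) v~w)

  ∈-neighbourhood⁻ : ∀ {v w} → w ∈ neighbourhood v → v ~ w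
  ∈-neighbourhood⁻ {v} {w} w∈ = trans (sym (lookup∘tabulate (Adj G v) w)) ([]=⇒lookup w∈)

  degree≡∣neighbourhood∣ : ∀ v → degree G v ≡ ∣ neighbourhood v ∣
  degree≡∣neighbourhood∣ v =
    trans (cong sum (map-tabulate id (λ j → if Adj G v j then 1 else 0)))
          (sum-indicator≡∣tabulate∣ (Adj G v))

  neighbour⇒1≤degree : ∀ {v w} → v ~ w → 1 ≤ degree G v
  neighbour⇒1≤degree {v} {w} v~w =
    subst₂ _≤_ (∣⁅x⁆∣≡1 w) (sym (degree≡∣neighbourhood∣ v)) (p⊆q⇒∣p∣≤∣q∣ ⁅w⁆⊆N)
    where
    ⁅w⁆⊆N : ⁅ w ⁆ ⊆ neighbourhood v
    ⁅w⁆⊆N x∈⁅w⁆ with refl ← x∈⁅y⁆⇒x≡y w x∈⁅w⁆ = ∈-neighbourhood⁺ v~w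

  connected⇒1≤degree : Connected G → ∀ {v w} → v ≢ w → 1 ≤ degree G v
  connected⇒1≤degree connected {v} {w} v≢w with connected v w
  ... | here       = ⊥-elim (v≢w refl)
  ... | step v~u _ = neighbour⇒1≤degree v~u

  ∃-neighbour-∉ : ∀ v (S : Subset n) → ∣ S ∣ < degree G v → ∃ λ w → v ~ w × w ∉ S
  ∃-neighbour-∉ v S ∣S∣<deg with any? (λ w → w ∈? neighbourhood v ×-dec ¬? (w ∈? S))
  ... | yes (w , w∈N , w∉S) = w , ∈-neighbourhood⁻ w∈N , w∉S
  ... | no  ∄ = ⊥-elim (<⇒≱ ∣S∣<deg
    (subst (_≤ ∣ S ∣) (sym (degree≡∣neighbourhood∣ v)) (p⊆q⇒∣p∣≤∣q∣ N⊆S)))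
    where
    N⊆S : neighbourhood v ⊆ S
    N⊆S {w} w∈N = decidable-stable (w ∈? S) (λ w∉S → ∄ (w , w∈N , w∉S))

  ∃-neighbour-avoiding : ∀ {v} → 4 ≤ degree G v → ∀ x y z → ∃ λ w → v ~ w × w ≢ x × w ≢ y × w ≢ z
  ∃-neighbour-avoiding {v} 4≤deg x y z with ∃-neighbour-∉ v (⁅ x ⁆ ∪ ⁅ y ⁆ ∪ ⁅ z ⁆) ∣xyz∣<deg
    where
    ∣xyz∣<deg : ∣ ⁅ x ⁆ ∪ ⁅ y ⁆ ∪ ⁅ z ⁆ ∣ < degree G v
    ∣xyz∣<deg = ≤-<-trans (∣⁅x⁆∪⁅y⁆∪⁅z⁆∣≤3 x y z) 4≤deg
  ... | w , v~w , w∉ = w , v~w , w≢x , w≢y , w≢z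
    where
    w≢x : w ≢ x
    w≢x refl = w∉ (x∈p∪q⁺ (inj₁ (x∈⁅x⁆ w)))
    w≢y : w ≢ y
    w≢y refl = w∉ (x∈p∪q⁺ (inj₂ (x∈p∪q⁺ (inj₁ (x∈⁅x⁆ w)))))
    w≢z : w ≢ z
    w≢z refl = w∉ (x∈p∪q⁺ (inj₂ (x∈p∪q⁺ (inj₂ (x∈⁅x⁆ w)))))

  -- A path is indexed by ℕ; positions beyond len carry no meaning.
  record Path : Set where
    field
      len       : ℕ
      at        : ℕ → Fin n
      injective : ∀ {i j} → i ≤ len → j ≤ len → at i ≡ at j → i ≡ j
      adjacent  : ∀ {i} → i < len → at i ~ at (suc i)
  open Path

  trivialPath : Fin n → Path
  trivialPath v = record
    { len = 0 ; at = λ _ → v ; injective = λ { z≤n z≤n _ → refl } ; adjacent = λ () }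

  len<n : ∀ P → len P < n
  len<n P = ≰⇒> λ n≤len →
    let i , j , i<j , same = pigeonhole (s≤s n≤len) (at P ∘ toℕ)
    in <⇒≢ i<j (injective P (toℕ≤pred[n] i) (toℕ≤pred[n] j) same)

  OnPath : Path → Fin n → Set
  OnPath P w = ∃ λ i → i ≤ len P × at P i ≡ w

  onPath? : ∀ P w → Dec (OnPath P w)
  onPath? P w = map′ (λ { (i , s≤s i≤len , e) → i , i≤len , e })
                     (λ { (i , i≤len , e) → i , s≤s i≤len , e })
                     (anyUpTo? (λ i → at P i ≟ᶠ w) (suc (len P)))

  _◃_ : Fin n → (ℕ → Fin n) → ℕ → Fin n
  (w ◃ f) zero    = w
  (w ◃ f) (suc i) = f i

  extend : (P : Path) {w : Fin n} → w ~ at P 0 → ¬ OnPath P w → Path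
  extend P {w} w~start w∉P = record
    { len = suc (len P) ; at = w ◃ at P ; injective = inj ; adjacent = adj }
    where
    inj : ∀ {i j} → i ≤ suc (len P) → j ≤ suc (len P) → (w ◃ at P) i ≡ (w ◃ at P) j → i ≡ j
    inj {zero}  {zero}  _         _         _ = refl
    inj {zero}  {suc j} _         (s≤s j≤) e = ⊥-elim (w∉P (j , j≤ , sym e))
    inj {suc i} {zero}  (s≤s i≤) _         e = ⊥-elim (w∉P (i , i≤ , e))
    inj {suc i} {suc j} (s≤s i≤) (s≤s j≤) e = cong suc (injective P i≤ j≤ e)
    adj : ∀ {i} → i < suc (len P) → (w ◃ at P) i ~ (w ◃ at P) (suc i)
    adj {zero}  _         = w~start
    adj {suc i} (s≤s i<) = adjacent P i<

  reindex : (P : Path) (L : ℕ) (ρ : ℕ → ℕ) →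
    (∀ {i} → i ≤ L → ρ i ≤ len P) →
    (∀ {i j} → i ≤ L → j ≤ L → ρ i ≡ ρ j → i ≡ j) →
    (∀ {i} → i < L → at P (ρ i) ~ at P (ρ (suc i))) → Path
  reindex P L ρ bounded ρ-injective ρ-adjacent = record
    { len = L ; at = at P ∘ ρ
    ; injective = λ i≤ j≤ e → ρ-injective i≤ j≤ (injective P (bounded i≤) (bounded j≤) e)
    ; adjacent = ρ-adjacent }

  segment : (P : Path) {lo hi : ℕ} → lo ≤ hi → hi ≤ len P → Path
  segment P {lo} {hi} lo≤hi hi≤len =
    reindex P (hi ∸ lo) (_+ lo) (λ {i} i≤ → ≤-trans (m≤o∸n⇒m+n≤o i lo≤hi i≤) hi≤len)
      (λ {i} {j} _ _ → +-cancelʳ-≡ lo i j)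
      (λ {i} i< → adjacent P (≤-trans (m≤o∸n⇒m+n≤o (suc i) lo≤hi i<) hi≤len))

  OnPath-segment⁻ : ∀ P {lo hi} (lo≤hi : lo ≤ hi) (hi≤len : hi ≤ len P) {w} →
    OnPath (segment P lo≤hi hi≤len) w → ∃ λ k → lo ≤ k × k ≤ hi × at P k ≡ w
  OnPath-segment⁻ P {lo} lo≤hi _ (i , i≤ , e) = i + lo , m≤n+m lo i , m≤o∸n⇒m+n≤o i lo≤hi i≤ , e

  -- Pósa rotation along the chord from the start: v_a … v₀ v_{a+1} … v_len.
  rotate : (P : Path) (a : ℕ) → suc a ≤ len P → at P 0 ~ at P (suc a) → Path
  rotate P a a<len chord = reindex P (len P) (rotation a) bounded ρ-injective ρ-adjacent
    where
    a≤len : a ≤ len P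
    a≤len = <⇒≤ a<len
    bounded : ∀ {i} → i ≤ len P → rotation a i ≤ len P
    bounded {i} i≤len with i ≤? a
    ... | yes _ = ≤-trans (m∸n≤m a i) a≤len
    ... | no  _ = i≤len
    ρ-injective : ∀ {i j} → i ≤ len P → j ≤ len P → rotation a i ≡ rotation a j → i ≡ j
    ρ-injective {i} {j} _ _ e with i ≤? a | j ≤? a
    ... | yes i≤a | yes j≤a = ∸-cancelˡ-≡ i≤a j≤a e
    ... | yes _   | no  j≰a = ⊥-elim (j≰a (≤-trans (≤-reflexive (sym e)) (m∸n≤m a i)))
    ... | no  i≰a | yes _   = ⊥-elim (i≰a (≤-trans (≤-reflexive e) (m∸n≤m a j)))
    ... | no  _   | no  _   = e
    ρ-adjacent : ∀ {i} → i < len P → at P (rotation a i) ~ at P (rotation a (suc i))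
    ρ-adjacent {i} i<len with i ≤? a | suc i ≤? a
    ... | yes _   | yes i<a =
      subst (λ m → at P m ~ at P (a ∸ suc i)) (sym a∸i≡) (~-sym (adjacent P a∸i≤len))
      where
      a∸i≡ : a ∸ i ≡ suc (a ∸ suc i)
      a∸i≡ = +-∸-assoc 1 i<a
      a∸i≤len : suc (a ∸ suc i) ≤ len P
      a∸i≤len = subst (_≤ len P) a∸i≡ (≤-trans (m∸n≤m a i) a≤len)
    ... | yes i≤a | no  i≮a with refl ← ≤-antisym i≤a (≮⇒≥ i≮a) =
      subst (λ m → at P m ~ at P (suc i)) (sym (n∸n≡0 i)) chord
    ... | no  i≰a | yes i<a = ⊥-elim (i≰a (<⇒≤ i<a))
    ... | no  _   | no  _   = adjacent P i<len

  chordCycle : (P : Path) {x : ℕ} → 2 ≤ x → x ≤ len P → at P 0 ~ at P x → Cycle G (suc x)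
  chordCycle P {x} 2≤x x≤len chord = record
    { len≥3    = s≤s 2≤x
    ; vert     = at P ∘ toℕ
    ; distinct = λ {i} {j} e → toℕ-injective (injective P (onP i) (onP j) e)
    ; consec   = consec
    ; closing  = λ i j i≡x j≡0 → subst₂ (λ k l → at P k ~ at P l) (sym i≡x) (sym j≡0) (~-sym chord)
    }
    where
    onP : (i : Fin (suc x)) → toℕ i ≤ len P
    onP i = ≤-trans (toℕ≤pred[n] i) x≤len
    consec : ∀ i j → suc (toℕ i) ≡ toℕ j → at P (toℕ i) ~ at P (toℕ j)
    consec i j i+1≡j = subst (λ k → at P (toℕ i) ~ at P k) i+1≡j
      (adjacent P (≤-trans (subst (_≤ x) (sym i+1≡j) (toℕ≤pred[n] j)) x≤len))

  detourCycle : (P : Path) {s₀ s₁ s₂ lo hi : ℕ} → s₀ < lo → s₁ < lo → s₂ < lo →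
    s₀ ≢ s₁ → s₀ ≢ s₂ → s₁ ≢ s₂ → lo ≤ hi → hi ≤ len P →
    at P s₀ ~ at P s₁ → at P s₁ ~ at P s₂ → at P s₂ ~ at P lo → at P hi ~ at P s₀ →
    Cycle G (4 + (hi ∸ lo))
  detourCycle P {s₀} {s₁} {s₂} {lo} {hi} s₀<lo s₁<lo s₂<lo s₀≢s₁ s₀≢s₂ s₁≢s₂ lo≤hi hi≤len
              e₀₁ e₁₂ e₂ closing =
    chordCycle T₀ (s≤s (s≤s z≤n)) ≤-refl
      (subst (λ k → at P s₀ ~ at P k) (sym (m∸n+n≡m lo≤hi)) (~-sym closing))
    where
    onP : ∀ {s} → s < lo → s ≤ len P
    onP s<lo = ≤-trans (<⇒≤ s<lo) (≤-trans lo≤hi hi≤len)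
    distinct : ∀ {s t} → s < lo → t < lo → s ≢ t → at P s ≢ at P t
    distinct s< t< s≢t = s≢t ∘ injective P (onP s<) (onP t<)
    S = segment P lo≤hi hi≤len
    ∉S : ∀ {s} → s < lo → ¬ OnPath S (at P s)
    ∉S s<lo on with OnPath-segment⁻ P lo≤hi hi≤len on
    ... | k , lo≤k , k≤hi , e with refl ← injective P (≤-trans k≤hi hi≤len) (onP s<lo) e =
      <⇒≱ s<lo lo≤k
    T₂ = extend S e₂ (∉S s₂<lo)
    s₁∉T₂ : ¬ OnPath T₂ (at P s₁)
    s₁∉T₂ (zero  , _ , e) = distinct s₁<lo s₂<lo s₁≢s₂ (sym e)
    s₁∉T₂ (suc i , s≤s i≤ , e) = ∉S s₁<lo (i , i≤ , e)
    T₁ = extend T₂ e₁₂ s₁∉T₂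
    s₀∉T₁ : ¬ OnPath T₁ (at P s₀)
    s₀∉T₁ (zero        , _ , e) = distinct s₀<lo s₁<lo s₀≢s₁ (sym e)
    s₀∉T₁ (suc zero    , _ , e) = distinct s₀<lo s₂<lo s₀≢s₂ (sym e)
    s₀∉T₁ (suc (suc i) , s≤s (s≤s i≤) , e) = ∉S s₀<lo (i , i≤ , e)
    T₀ = extend T₁ e₀₁ s₀∉T₁

  Longest : Path → Set
  Longest P = ∀ Q → len Q ≤ len P

  longest-exists : Path → ¬ ¬ Σ Path Longest
  longest-exists P = go n P (m≤m+n n (len P))
    where
    go : ∀ k P → n ≤ k + len P → ¬ ¬ Σ Path Longest
    go zero    P n≤len _ = <⇒≱ (len<n P) n≤len
    go (suc k) P n≤k+len ∄longest = ∄longest (P , longest)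
      where
      longest : Longest P
      longest Q with len Q ≤? len P
      ... | yes Q≤P = Q≤P
      ... | no  Q≰P = ⊥-elim (go k Q n≤k+lenQ ∄longest)
        where
        n≤k+lenQ : n ≤ k + len Q
        n≤k+lenQ = ≤-trans n≤k+len
          (≤-trans (≤-reflexive (sym (+-suc k (len P)))) (+-monoʳ-≤ k (≰⇒> Q≰P)))

  longest⇒start-neighbours-on : ∀ P → Longest P → ∀ {w} → at P 0 ~ w → OnPath P w
  longest⇒start-neighbours-on P longest {w} start~w with onPath? P w
  ... | yes w∈P = w∈P
  ... | no  w∉P = ⊥-elim (1+n≰n (longest (extend P (~-sym start~w) w∉P)))

  longest⇒chord : ∀ P → Longest P → ∀ {w} → at P 0 ~ w → w ≢ at P 1 →
    ∃ λ x → 2 ≤ x × x ≤ len P × at P x ≡ w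
  longest⇒chord P longest start~w w≢second with longest⇒start-neighbours-on P longest start~w
  ... | zero        , _     , refl = ⊥-elim (~-irrefl start~w)
  ... | suc zero    , _     , refl = ⊥-elim (w≢second refl)
  ... | suc (suc x) , x≤len , refl = suc (suc x) , s≤s (s≤s z≤n) , x≤len , refl

  module _ (cycles≡2 : ∀ k → Cycle G k → k % 4 ≡ 2) where

    twoChords⇒⊥ : (P : Path) {a j x : ℕ} → 1 ≤ a → suc a < j → suc a < x → j ≢ x →
      j ≤ len P → x ≤ len P →
      at P 0 ~ at P (suc a) → at P a ~ at P j → at P 0 ~ at P x → ⊥
    twoChords⇒⊥ P {a} {j} {x} 1≤a a<j a<x j≢x j≤len x≤len chord a~j 0~x = byOrder (<-cmp j x)
      where
      a<len : suc a ≤ len P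
      a<len = ≤-trans (<⇒≤ a<j) j≤len
      x≡2 : suc x % 4 ≡ 2
      x≡2 = cycles≡2 _ (chordCycle P (<-≤-trans (s≤s (s≤s z≤n)) a<x) x≤len 0~x)
      j≡2 : suc j % 4 ≡ 2
      j≡2 = cycles≡2 _ (chordCycle (rotate P a a<len chord) (<-≤-trans (s≤s (s≤s z≤n)) a<j) j≤len
              (subst (λ k → at P a ~ at P k) (sym (rotation-> (<-trans (n<1+n a) a<j))) a~j))
      byOrder : Tri (j < x) (j ≡ x) (x < j) → ⊥
      byOrder (tri≈ _ j≡x _) = j≢x j≡x
      byOrder (tri< j<x _ _) = ≡2[mod4]⇒detour≢2[mod4] (<⇒≤ j<x) j≡2 x≡2 (cycles≡2 _
        (detourCycle P (<-trans (s≤s z≤n) a<j) a<j (<-trans (n<1+n a) a<j)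
          (λ ()) (<⇒≢ 1≤a) (≢-sym (<⇒≢ (n<1+n a)))
          (<⇒≤ j<x) x≤len chord (~-sym (adjacent P a<len)) a~j (~-sym 0~x)))
      byOrder (tri> _ _ x<j) = ≡2[mod4]⇒detour≢2[mod4] (<⇒≤ x<j) x≡2 j≡2 (cycles≡2 _
        (detourCycle P (<-trans (n<1+n a) a<x) a<x (<-trans (s≤s z≤n) a<x)
          (<⇒≢ (n<1+n a)) (≢-sym (<⇒≢ 1≤a)) (λ ())
          (<⇒≤ x<j) j≤len (adjacent P a<len) (~-sym chord) 0~x (~-sym a~j)))

    module _ (degree≥4 : ∀ v → 4 ≤ degree G v) where

      Chordless : ℕ → Set
      Chordless a = ∀ P → Longest P → 2 ≤ a → a ≤ len P → at P 0 ~ at P a → ⊥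

      beyondChord : ∀ P {a₀ j} → Longest P → 1 ≤ a₀ → suc a₀ < j → j ≤ len P →
        at P 0 ~ at P (suc a₀) → at P a₀ ~ at P j → (∀ {b} → b < suc a₀ → Chordless b) → ⊥
      beyondChord P {a₀} {j} longest 1≤a₀ a<j j≤len chord a₀~j shorter
        with ∃-neighbour-avoiding (degree≥4 (at P 0)) (at P 1) (at P (suc a₀)) (at P j)
      ... | w , 0~w , w≢1 , w≢a , w≢j with longest⇒chord P longest 0~w w≢1
      ... | x , 2≤x , x≤len , refl with <-cmp x (suc a₀)
      ... | tri< x<a _ _ = shorter x<a P longest 2≤x x≤len 0~w
      ... | tri≈ _ x≡a _ = w≢a (cong (at P) x≡a)
      ... | tri> _ _ a<x = twoChords⇒⊥ P 1≤a₀ a<j a<x (λ j≡x → w≢j (cong (at P) (sym j≡x)))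
                             j≤len x≤len chord a₀~j 0~w

      chordless : ∀ a → Chordless a
      chordless = <-rec Chordless shorten
        where
        shorten : ∀ a → (∀ {b} → b < a → Chordless b) → Chordless a
        shorten zero           _ _ _ ()        _ _
        shorten (suc zero)     _ _ _ (s≤s ()) _ _
        shorten (suc (suc a₁)) shorter P longest _ a≤len chord
          with ∃-neighbour-avoiding (degree≥4 (at P (suc a₁)))
                 (at P a₁) (at P (2 + a₁)) (at P (2 + a₁))
        ... | w , a₀~w , w≢a₁ , w≢a , _
          with longest⇒start-neighbours-on (rotate P (suc a₁) a≤len chord) longest a₀~w
        ... | zero , _ , refl = ~-irrefl a₀~w
        ... | suc zero , _ , refl = w≢a₁ (cong (at P) (rotation-≤ (s≤s z≤n)))
        ... | i@(suc (suc _)) , i≤len , refl with suc a₁ <? i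
        ... | no  a₀≮i = shorter (s≤s (≮⇒≥ a₀≮i)) (rotate P (suc a₁) a≤len chord) longest
                           (s≤s (s≤s z≤n)) i≤len a₀~w
        ... | yes a₀<i = beyondChord P longest (s≤s z≤n) a<i i≤len chord
                           (subst (λ k → at P (suc a₁) ~ at P k) (rotation-> a₀<i) a₀~w) shorter
          where
          a<i : 2 + a₁ < i
          a<i = ≤∧≢⇒< a₀<i λ a≡i → w≢a (cong (at P) (trans (rotation-> a₀<i) (sym a≡i)))

      ¬vertex : ¬ Fin n
      ¬vertex v = longest-exists (trivialPath v) λ (P , longest) →
        let w , 0~w , w≢1 , _ = ∃-neighbour-avoiding (degree≥4 (at P 0)) (at P 1) (at P 1) (at P 1)
            x , 2≤x , x≤len , x↦w = longest⇒chord P longest 0~w w≢1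
        in chordless x P longest 2≤x x≤len (subst (at P 0 ~_) (sym x↦w) 0~w)

theorem14 : ∀ {n} (G : Graph n) → 2 ≤ n → InEps2 G → ∃ λ (v : Fin n) → degree G v ≡ 2
theorem14 {suc (suc _)} G (s≤s (s≤s _)) ((connected , even) , cycles≡2)
  with any? (λ v → degree G v ≟ 2)
... | yes deg≡2 = deg≡2
... | no  ∄deg≡2 = ⊥-elim (¬vertex G cycles≡2 degree≥4 fzero)
  where
  degree≥4 : ∀ v → 4 ≤ degree G v
  degree≥4 v = even∧positive∧≢2⇒≥4 (even v)
    (connected⇒1≤degree G connected (≢-sym (punchInᵢ≢i v fzero)))
    (λ deg≡2 → ∄deg≡2 (v , deg≡2))
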